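{- Let $m\ge1$, $n\ge2$, and let $D$ be a $C_3$-simple orientation of the fan $F_{m,n}=\overline{K_m}+P_n$ with centers $c_1,\dots,c_m$. Then the directed metric dimension of $D$ is \[\dim(D)=\begin{cases}1 & \text{for } m=1 \text{ and } n=2,3,4;\\ m-1 & \text{for } m\ge2 \text{ and } n=2;\\ m & \text{for } m\ge 2 \text{ and } n=3,4;\\ m+1 & \text{for } m\ge 2\text{ and } n=5;\\ \frac{n}{2}+m-2 & \text{for } n \text{ even}, n\ge 6;\\ \frac{n-1}{2}+m-2 & \text{for } n \text{ odd}, n\ge 7, \text{ and } od(c_i)>id(c_i) \text{ for all } i;\\ \frac{n-1}{2}+m-1 & \text{for } n \text{ odd}, n\ge7, \text{ and } od(c_i)<id(c_i) \text{ for all } i.\end{cases}\]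
   Context: The fan $F_{m,n}$ is $\overline{K_m}+P_n$: $m$ pairwise nonadjacent centers $c_1,\dots,c_m$, each adjacent to every vertex of a path $v_1v_2\cdots v_n$. An orientation is $C_3$-simple if every triangle of the underlying graph becomes a directed (strongly connected) $3$-cycle. $od(v)$ and $id(v)$ denote the out-degree and in-degree of $v$ in the oriented graph. For a strongly connected oriented graph $D$, $d(u,v)$ is the minimum length of a directed path from $u$ to $v$; for a nonempty ordered set $B=\{b_1,\dots,b_k\}\subseteq V(D)$, $r(v|B)=(d(v,b_1),\dots,d(v,b_k))$; $B$ is resolving if distinct vertices have distinct representations; $\dim(D)$ is the minimum cardinality of a resolving set. -}

module Defs where

open import Data.Nat using (ℕ; zero; suc; _+_; _*_; _∸_; _≤_; _<_)
open import Data.Fin using (Fin; toℕ)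
open import Data.Bool using (Bool; true; false)
open import Data.List using (List; []; _∷_; map; _++_; length; allFin)
open import Data.List.Membership.Propositional using (_∈_)
open import Data.List.Relation.Unary.Unique.Propositional using (Unique)
open import Data.Sum using (_⊎_; inj₁; inj₂)
open import Data.Product using (_×_; Σ; ∃; _,_)
open import Data.Empty using (⊥)
open import Data.Unit using (⊤)
open import Relation.Nullary using (¬_)
open import Relation.Binary.PropositionalEquality using (_≡_; _≢_)
open import Function.Bundles using (_⇔_)

-- Oriented graphs (digraphs) on a vertex type V, given by an arc
-- predicate  A u v ≡ true  meaning  u → v.

Arcs : Set → Set
Arcs V = V → V → Bool

data Walk {V : Set} (A : Arcs V) : ℕ → V → V → Set where
  here : ∀ {u} → Walk A 0 u u
  step : ∀ {k u w v} → A u w ≡ true → Walk A k w v → Walk A (suc k) u v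

Dist : {V : Set} → Arcs V → V → V → ℕ → Set
Dist A u v k = Walk A k u v × (∀ j → j < k → ¬ Walk A j u v)

StronglyConnected : {V : Set} → Arcs V → Set
StronglyConnected A = ∀ u v → ∃ λ k → Walk A k u v

SameRep : {V : Set} → Arcs V → List V → V → V → Set
SameRep A B u v = ∀ b → b ∈ B → ∀ k → (Dist A u b k ⇔ Dist A v b k)

Resolving : {V : Set} → Arcs V → List V → Set
Resolving A B = (B ≢ []) × Unique B × (∀ u v → SameRep A B u v → u ≡ v)

-- dim(D) = d  (D strongly connected so that dim is defined)
MetricDim : {V : Set} → Arcs V → ℕ → Set
MetricDim {V} A d =
  StronglyConnected A
  × (Σ (List V) λ B → Resolving A B × length B ≡ d)
  × (∀ B → Resolving A B → d ≤ length B)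

-- The fan F_{m,n}: centers inj₁ i (i : Fin m), path vertices inj₂ j
-- (j : Fin n), path v_0 v_1 ... v_{n-1} (0-indexed).

FanV : ℕ → ℕ → Set
FanV m n = Fin m ⊎ Fin n

FanEdge : ∀ {m n} → FanV m n → FanV m n → Set
FanEdge (inj₁ _) (inj₁ _) = ⊥
FanEdge (inj₁ _) (inj₂ _) = ⊤
FanEdge (inj₂ _) (inj₁ _) = ⊤
FanEdge (inj₂ i) (inj₂ j) = (toℕ j ≡ suc (toℕ i)) ⊎ (toℕ i ≡ suc (toℕ j))

IsFanOrientation : ∀ {m n} → Arcs (FanV m n) → Set
IsFanOrientation {m} {n} O =
  ∀ (x y : FanV m n) →
    (O x y ≡ true → FanEdge x y)
    × (FanEdge x y → (O x y ≡ true) ⊎ (O y x ≡ true))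
    × ¬ ((O x y ≡ true) × (O y x ≡ true))

C3Simple : ∀ {m n} → Arcs (FanV m n) → Set
C3Simple {m} {n} O =
  ∀ (x y z : FanV m n) → FanEdge x y → FanEdge y z → FanEdge x z →
    ((O x y ≡ true) × (O y z ≡ true) × (O z x ≡ true))
    ⊎ ((O y x ≡ true) × (O z y ≡ true) × (O x z ≡ true))

allFanV : ∀ m n → List (FanV m n)
allFanV m n = map inj₁ (allFin m) ++ map inj₂ (allFin n)

countTrue : List Bool → ℕ
countTrue [] = 0
countTrue (true ∷ bs) = suc (countTrue bs)
countTrue (false ∷ bs) = countTrue bs

outdeg : ∀ {m n} → Arcs (FanV m n) → FanV m n → ℕ
outdeg {m} {n} O x = countTrue (map (O x) (allFanV m n))

indeg : ∀ {m n} → Arcs (FanV m n) → FanV m n → ℕ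
indeg {m} {n} O x = countTrue (map (λ w → O w x) (allFanV m n))

-- A C3-simple orientation makes every triangle c v_i v_(i+1) cyclic, so each centre
-- points to v_i exactly when it does not point to v_(i+1), and the path edge leaves the
-- vertex the centre points to.  As the centres share the path edges, they all agree,
-- and there are only two such orientations, told apart by the direction of c v_0.
-- Call the path vertices the centres point to heads and the others tails: every arc
-- goes centre → head → tail → centre, so the length of a walk is fixed modulo 3 by the
-- layers of its ends, and all distances are at most 3 except from a head to a
-- non-adjacent tail (4).
--
-- All centres are twins, and so are all tails; a resolving set therefore misses at most
-- one of each, giving dim ≥ (m - 1) + (#tails - 1).  For n ≥ 6 this bound is attained
-- by the other centres together with the tails among v_2 … v_(n-1): two heads are then
-- always separated by a tail adjacent to just one of them.  Counting tails by the parity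
-- of n gives the formulas (for odd n the degree condition fixes the orientation).  The
-- fans with n ≤ 5 are settled directly; when n is 3 or 5 and c v_0 is an arc, a pair of
-- heads with equal distances to all remaining vertices raises the bound by one.

module Submission where

open import Defs
open import Data.Bool using (Bool; true; false; not; _∧_; _∨_; if_then_else_; T) renaming (_≟_ to _≟ᵇ_)
open import Data.Bool.Properties using (not-involutive; ∨-comm; ∧-zeroʳ; ∧-identityʳ; T-∧)
open import Data.Empty using (⊥-elim)
open import Data.Fin using (Fin; toℕ; fromℕ<; inject₁) renaming (zero to fz; suc to fs; _≟_ to _≟ᶠ_)
open import Data.Fin.Properties using (toℕ<n; toℕ-fromℕ<; fromℕ<-toℕ; toℕ-inject₁; toℕ-injective; suc-injective; all?; any?)
open import Data.List using (List; []; _∷_; length; map; _++_; allFin; filter; filterᵇ; tabulate)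
open import Data.List.Properties using (length-++; length-map; length-tabulate; length-removeAt′; filter-++; filter-all; map-++; map-∘; map-tabulate; map-cong)
open import Data.List.Membership.Propositional.Properties using (∈-map⁺; ∈-map⁻; ∈-++⁺ˡ; ∈-++⁺ʳ; ∈-++⁻; ∈-allFin; ∈-filter⁺; ∈-filter⁻)
open import Data.List.Relation.Unary.Unique.Propositional using (Unique)
open import Data.List.Relation.Unary.Unique.Propositional.Properties using (map⁺; ++⁺; allFin⁺; filter⁺)
open import Data.List.Membership.Propositional using (_∈_; _∉_)
open import Data.List.Relation.Unary.Any using (here; there; index; _─_)
import Data.List.Relation.Unary.All as All
open import Data.List.Relation.Unary.All using ([]; _∷_)
open import Data.List.Relation.Unary.AllPairs using ([]; _∷_)
open import Data.Nat using (ℕ; zero; suc; _+_; _*_; _∸_; _≤_; _<_; z≤n; s≤s; _≡ᵇ_; _≤ᵇ_)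
import Data.Nat.Properties as ℕ
open import Data.Product using (_×_; _,_; proj₁; proj₂; Σ-syntax; ∃-syntax)
open import Data.Sum using (_⊎_; inj₁; inj₂)
open import Data.Sum.Properties using (≡-dec; inj₁-injective; inj₂-injective)
import Data.Sum
open import Data.Unit using (tt)
open import Function using (_∘_; case_of_)
open import Function.Bundles using (mk⇔; Equivalence)
open import Relation.Binary.Definitions using (DecidableEquality; tri<; tri≈; tri>)
open import Relation.Binary.PropositionalEquality
open import Relation.Nullary using (¬_; Dec; yes; no; ¬?; _×-dec_; _→-dec_)
open import Relation.Nullary.Decidable using (T?; True; toWitness)

private variable
  V : Set
  A A′ : Arcs V

-- Walks and distances in a digraph

module _ {V : Set} {A : Arcs V} where

  Walk-zero⇒≡ : ∀ {x y} → Walk A 0 x y → x ≡ y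
  Walk-zero⇒≡ here = refl

  _++ʷ_ : ∀ {k k′ x y z} → Walk A k x y → Walk A k′ y z → Walk A (k + k′) x z
  here ++ʷ w′ = w′
  step a w ++ʷ w′ = step a (w ++ʷ w′)

  arc⇒Walk : ∀ {x y} → A x y ≡ true → Walk A 1 x y
  arc⇒Walk a = step a here

  Dist-refl : ∀ x → Dist A x x 0
  Dist-refl x = here , λ _ ()

  Dist-unique : ∀ {x y k k′} → Dist A x y k → Dist A x y k′ → k ≡ k′
  Dist-unique {k = k} {k′} (w , min) (w′ , min′) with ℕ.<-cmp k k′
  ... | tri< k<k′ _ _ = ⊥-elim (min′ k k<k′ w)
  ... | tri≈ _ k≡k′ _ = k≡k′
  ... | tri> _ _ k′<k = ⊥-elim (min k′ k′<k w′)

  module DistanceFunction (d : V → V → ℕ) (d-Dist : ∀ x y → Dist A x y (d x y)) where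

    stronglyConnected : StronglyConnected A
    stronglyConnected x y = d x y , proj₁ (d-Dist x y)

    SameRep⇒≡ : ∀ {B u v} → SameRep A B u v → ∀ y → y ∈ B → d u y ≡ d v y
    SameRep⇒≡ {u = u} {v} rep y y∈B =
      sym (Dist-unique (d-Dist v y) (Equivalence.to (rep y y∈B (d u y)) (d-Dist u y)))

    ≡⇒SameRep : ∀ {B u v} → (∀ y → y ∈ B → d u y ≡ d v y) → SameRep A B u v
    ≡⇒SameRep {u = u} {v} same y y∈B k = mk⇔
      (λ dist → subst (Dist A v y) (sym (trans (Dist-unique dist (d-Dist u y)) (same y y∈B))) (d-Dist v y))
      (λ dist → subst (Dist A u y) (trans (same y y∈B) (Dist-unique (d-Dist v y) dist)) (d-Dist u y))

    d-zero⇒≡ : ∀ {x y} → d x y ≡ 0 → x ≡ y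
    d-zero⇒≡ {x} {y} dxy≡0 = Walk-zero⇒≡ (subst (λ k → Walk A k x y) dxy≡0 (proj₁ (d-Dist x y)))

    d-refl : ∀ x → d x x ≡ 0
    d-refl x = Dist-unique (d-Dist x x) (Dist-refl x)

    agree-at-member⇒≡ : ∀ {B u v} → (∀ y → y ∈ B → d u y ≡ d v y) → v ∈ B → u ≡ v
    agree-at-member⇒≡ {v = v} same v∈B = d-zero⇒≡ (trans (same v v∈B) (d-refl v))

    resolves : ∀ {B} → Resolving A B → ∀ u v → (∀ y → y ∈ B → d u y ≡ d v y) → u ≡ v
    resolves (_ , _ , res) u v same = res u v (≡⇒SameRep same)

Resolving⇒1≤length : ∀ {B} → Resolving A B → 1 ≤ length B
Resolving⇒1≤length {B = []} (B≢[] , _) = ⊥-elim (B≢[] refl)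
Resolving⇒1≤length {B = _ ∷ _} _ = s≤s z≤n

_≗ᴬ_ : Arcs V → Arcs V → Set
A ≗ᴬ A′ = ∀ x y → A x y ≡ A′ x y

≗ᴬ-sym : A ≗ᴬ A′ → A′ ≗ᴬ A
≗ᴬ-sym eq x y = sym (eq x y)

Walk-cong : A ≗ᴬ A′ → ∀ {k x y} → Walk A k x y → Walk A′ k x y
Walk-cong eq here = here
Walk-cong eq (step {u = u} {w} a w′) = step (trans (sym (eq u w)) a) (Walk-cong eq w′)

Dist-cong : A ≗ᴬ A′ → ∀ {x y k} → Dist A x y k → Dist A′ x y k
Dist-cong eq (w , min) = Walk-cong eq w , λ j j<k w′ → min j j<k (Walk-cong (≗ᴬ-sym eq) w′)

SameRep-cong : A ≗ᴬ A′ → ∀ {B u v} → SameRep A B u v → SameRep A′ B u v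
SameRep-cong eq rep y y∈B k = mk⇔
  (λ d → Dist-cong eq (Equivalence.to (rep y y∈B k) (Dist-cong (≗ᴬ-sym eq) d)))
  (λ d → Dist-cong eq (Equivalence.from (rep y y∈B k) (Dist-cong (≗ᴬ-sym eq) d)))

Resolving-cong : A ≗ᴬ A′ → ∀ {B} → Resolving A B → Resolving A′ B
Resolving-cong eq (B≢[] , unique , res) =
  B≢[] , unique , λ u v rep → res u v (SameRep-cong (≗ᴬ-sym eq) rep)

MetricDim-cong : A ≗ᴬ A′ → ∀ {d} → MetricDim A d → MetricDim A′ d
MetricDim-cong eq (connected , (B , res , |B|≡d) , minimal) =
  (λ x y → proj₁ (connected x y) , Walk-cong eq (proj₂ (connected x y))) ,
  (B , Resolving-cong eq res , |B|≡d) ,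
  λ B′ res′ → minimal B′ (Resolving-cong (≗ᴬ-sym eq) res′)

∉⇒≢ : ∀ {X : Set} {B : List X} {x y} → x ∉ B → y ∈ B → x ≢ y
∉⇒≢ x∉B y∈B refl = x∉B y∈B

nonempty⇒member : ∀ {X : Set} (L : List X) → L ≢ [] → Σ[ x ∈ X ] x ∈ L
nonempty⇒member [] L≢[] = ⊥-elim (L≢[] refl)
nonempty⇒member (x ∷ _) _ = x , here refl

Unique-⊆⇒length≤ : ∀ {X : Set} {L B : List X} → Unique L → (∀ {y} → y ∈ L → y ∈ B) → length L ≤ length B
Unique-⊆⇒length≤ {L = []} _ _ = z≤n
Unique-⊆⇒length≤ {L = x ∷ L} {B} (x∉L ∷ uniqueL) L⊆B =
  subst (suc (length L) ≤_) (sym (length-removeAt′ B (index x∈B)))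
    (s≤s (Unique-⊆⇒length≤ uniqueL (λ y∈L → ∈-─ B x∈B (L⊆B (there y∈L)) (All.lookup x∉L y∈L ∘ sym))))
  where
  x∈B : x ∈ B
  x∈B = L⊆B (here refl)
  ∈-─ : ∀ {x y} (B : List _) (x∈B : x ∈ B) → y ∈ B → y ≢ x → y ∈ (B ─ x∈B)
  ∈-─ (_ ∷ _) (here refl) (here refl) y≢x = ⊥-elim (y≢x refl)
  ∈-─ (_ ∷ _) (here _) (there y∈B) _ = y∈B
  ∈-─ (_ ∷ _) (there _) (here refl) _ = here refl
  ∈-─ (_ ∷ B) (there x∈B) (there y∈B) y≢x = there (∈-─ B x∈B y∈B y≢x)

module Counting {X : Set} (_≟_ : DecidableEquality X) where

  open import Data.List.Membership.DecPropositional _≟_ using (_∈?_)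

  countIn : List X → List X → ℕ
  countIn B L = length (filter (_∈? B) L)

  countIn≤length : ∀ B {L} → Unique L → countIn B L ≤ length B
  countIn≤length B {L} uniqueL = Unique-⊆⇒length≤ (filter⁺ (_∈? B) uniqueL) (proj₂ ∘ ∈-filter⁻ (_∈? B) {xs = L})

  countIn-++ : ∀ B L L′ → countIn B (L ++ L′) ≡ countIn B L + countIn B L′
  countIn-++ B L L′ = trans (cong length (filter-++ (_∈? B) L L′)) (length-++ (filter (_∈? B) L))

  countIn-⊆ : ∀ B {L} → (∀ {y} → y ∈ L → y ∈ B) → countIn B L ≡ length L
  countIn-⊆ B L⊆B = cong length (filter-all (_∈? B) (All.tabulate L⊆B))

  length≤1+countIn : ∀ B {L} → Unique L → (∀ {x y} → x ∈ L → y ∈ L → x ∉ B → y ∉ B → x ≡ y) →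
    length L ≤ suc (countIn B L)
  length≤1+countIn B {[]} _ _ = z≤n
  length≤1+countIn B {x ∷ L} (x∉L ∷ uniqueL) oneOutside with x ∈? B
  ... | yes _ = s≤s (length≤1+countIn B uniqueL (λ p q → oneOutside (there p) (there q)))
  ... | no x∉B = s≤s (ℕ.≤-reflexive (sym (countIn-⊆ B L⊆B)))
    where
    L⊆B : ∀ {y} → y ∈ L → y ∈ B
    L⊆B {y} y∈L with y ∈? B
    ... | yes y∈B = y∈B
    ... | no y∉B = ⊥-elim (All.lookup x∉L y∈L (oneOutside (here refl) (there y∈L) x∉B y∉B))

count : (ℕ → Bool) → ℕ → ℕ
count h zero = 0
count h (suc n) = (if h 0 then 1 else 0) + count (h ∘ suc) n

count-cong : ∀ {h h′} n → (∀ k → h k ≡ h′ k) → count h n ≡ count h′ n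
count-cong zero _ = refl
count-cong {h} (suc n) h≗h′ = cong₂ _+_ (cong (λ a → if a then 1 else 0) (h≗h′ 0)) (count-cong n (h≗h′ ∘ suc))

length-filterᵇ-tabulate : ∀ {X : Set} (p : X → Bool) (h : ℕ → Bool) n (g : Fin n → X) →
  (∀ i → p (g i) ≡ h (toℕ i)) → length (filterᵇ p (tabulate g)) ≡ count h n
length-filterᵇ-tabulate p h zero g _ = refl
length-filterᵇ-tabulate p h (suc n) g p∘g≗h rewrite sym (p∘g≗h fz) with p (g fz)
... | true = cong suc (length-filterᵇ-tabulate p (h ∘ suc) n (g ∘ fs) (p∘g≗h ∘ fs))
... | false = length-filterᵇ-tabulate p (h ∘ suc) n (g ∘ fs) (p∘g≗h ∘ fs)

countTrue-++ : ∀ bs bs′ → countTrue (bs ++ bs′) ≡ countTrue bs + countTrue bs′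
countTrue-++ [] bs′ = refl
countTrue-++ (true ∷ bs) bs′ = cong suc (countTrue-++ bs bs′)
countTrue-++ (false ∷ bs) bs′ = countTrue-++ bs bs′

countTrue-map : ∀ {X : Set} (g : X → Bool) L → countTrue (map g L) ≡ length (filterᵇ g L)
countTrue-map g [] = refl
countTrue-map g (x ∷ L) with g x
... | true = cong suc (countTrue-map g L)
... | false = countTrue-map g L

countTrue-map-false : ∀ {X : Set} (g : X → Bool) → (∀ x → g x ≡ false) → ∀ L → countTrue (map g L) ≡ 0
countTrue-map-false g g≡false [] = refl
countTrue-map-false g g≡false (x ∷ L) rewrite g≡false x = countTrue-map-false g g≡false L

-- whether the centres point to v_k, i.e. whether v_k is a head
arcFromCentre : Bool → ℕ → Bool
arcFromCentre b zero = b
arcFromCentre b (suc k) = not (arcFromCentre b k)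

pathAdjacent : ℕ → ℕ → Bool
pathAdjacent i j = (j ≡ᵇ suc i) ∨ (i ≡ᵇ suc j)

≡ᵇ-true⇒≡ : ∀ {a c} → (a ≡ᵇ c) ≡ true → a ≡ c
≡ᵇ-true⇒≡ {a} {c} e = ℕ.≡ᵇ⇒≡ a c (subst T (sym e) tt)

≡ᵇ-false⇒≢ : ∀ {a c} → (a ≡ᵇ c) ≡ false → a ≢ c
≡ᵇ-false⇒≢ {a} {c} e a≡c = subst T e (ℕ.≡⇒≡ᵇ a c a≡c)

≡ᵇ-refl : ∀ a → (a ≡ᵇ a) ≡ true
≡ᵇ-refl zero = refl
≡ᵇ-refl (suc a) = ≡ᵇ-refl a

≢ᵇ-2+ : ∀ a → (a ≡ᵇ suc (suc a)) ≡ false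
≢ᵇ-2+ zero = refl
≢ᵇ-2+ (suc a) = ≢ᵇ-2+ a

pathAdjacent-sym : ∀ i j → pathAdjacent i j ≡ pathAdjacent j i
pathAdjacent-sym i j = ∨-comm (j ≡ᵇ suc i) (i ≡ᵇ suc j)

pathAdjacent-pred : ∀ a → pathAdjacent (suc a) a ≡ true
pathAdjacent-pred a rewrite ≢ᵇ-2+ a | ≡ᵇ-refl a = refl

pathAdjacent-suc : ∀ a → pathAdjacent a (suc a) ≡ true
pathAdjacent-suc a rewrite ≡ᵇ-refl a = refl

pathAdjacent⇒arcFromCentre : ∀ b i j → pathAdjacent i j ≡ true → arcFromCentre b j ≡ not (arcFromCentre b i)
pathAdjacent⇒arcFromCentre b i j adj with j ≡ᵇ suc i in j≡1+i | i ≡ᵇ suc j in i≡1+j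
... | true | _ = cong (arcFromCentre b) (≡ᵇ-true⇒≡ {j} j≡1+i)
... | false | true rewrite ≡ᵇ-true⇒≡ {i} i≡1+j =
  sym (not-involutive (arcFromCentre b j))

arcFromCentre-not : ∀ b k → arcFromCentre (not b) k ≡ not (arcFromCentre b k)
arcFromCentre-not b zero = refl
arcFromCentre-not b (suc k) = cong not (arcFromCentre-not b k)

arcFromCentre-someTrue : ∀ b n → Σ[ j ∈ Fin (suc (suc n)) ] arcFromCentre b (toℕ j) ≡ true
arcFromCentre-someTrue true n = fz , refl
arcFromCentre-someTrue false n = fs fz , refl

tailsBelow : Bool → ℕ → ℕ
tailsBelow b = count (not ∘ arcFromCentre b)

-- exactly one of v₀ and v₁ is a tail, and the pattern repeats with period 2
tailsBelow-+2 : ∀ b k → tailsBelow b (suc (suc k)) ≡ suc (tailsBelow b k)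
tailsBelow-+2 b k = trans (one-of-two b) (cong suc (count-cong k (λ j → cong not (not-involutive (arcFromCentre b j)))))
  where
  one-of-two : ∀ b → tailsBelow b (suc (suc k)) ≡ suc (count (not ∘ arcFromCentre b ∘ suc ∘ suc) k)
  one-of-two true = refl
  one-of-two false = refl

tailsBelow-even : ∀ b k → tailsBelow b (2 * k) ≡ k
tailsBelow-even b zero = refl
tailsBelow-even b (suc k) =
  trans (cong (tailsBelow b) (ℕ.*-suc 2 k)) (trans (tailsBelow-+2 b (2 * k)) (cong suc (tailsBelow-even b k)))

tailsBelow-odd : ∀ b k → tailsBelow b (suc (2 * k)) ≡ k + (if b then 0 else 1)
tailsBelow-odd true zero = refl
tailsBelow-odd false zero = refl
tailsBelow-odd b (suc k) =
  trans (cong (tailsBelow b ∘ suc) (ℕ.*-suc 2 k)) (trans (tailsBelow-+2 b (suc (2 * k))) (cong suc (tailsBelow-odd b k)))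

pathAdjacent-far : ∀ a c → c ≢ suc a → a ≢ suc c → pathAdjacent a c ≡ false
pathAdjacent-far a c c≢1+a a≢1+c with c ≡ᵇ suc a in c≡1+a | a ≡ᵇ suc c in a≡1+c
... | true | _ = ⊥-elim (c≢1+a (≡ᵇ-true⇒≡ c≡1+a))
... | false | true = ⊥-elim (a≢1+c (≡ᵇ-true⇒≡ {a} a≡1+c))
... | false | false = refl

before-head-tail : ∀ b k → arcFromCentre b (suc k) ≡ true → arcFromCentre b k ≡ false
before-head-tail b k h = trans (sym (not-involutive (arcFromCentre b k))) (cong not h)

first-two-tails : ∀ b a a′ → a < 2 → a′ < 2 → arcFromCentre b a ≡ false → arcFromCentre b a′ ≡ false → a ≡ a′
first-two-tails b 0 0 _ _ _ _ = refl
first-two-tails b 1 1 _ _ _ _ = refl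
first-two-tails b 0 1 _ _ t t′ = case trans (sym t′) (cong not t) of λ ()
first-two-tails b 1 0 _ _ t t′ = case trans (sym t) (cong not t′) of λ ()
first-two-tails b (suc (suc _)) _ (s≤s (s≤s ())) _ _ _
first-two-tails b _ (suc (suc _)) _ (s≤s (s≤s ())) _ _

tailsBelow-positive : ∀ b k → 2 ≤ k → 0 < tailsBelow b k
tailsBelow-positive b (suc (suc k)) _ = subst (0 <_) (sym (tailsBelow-+2 b k)) (s≤s z≤n)
tailsBelow-positive b (suc zero) (s≤s ())

n≢1+k+n : ∀ k a → a ≢ suc (k + a)
n≢1+k+n k a = ℕ.<⇒≢ (s≤s (ℕ.m≤n+m a k))

T-not⇒≡false : ∀ {a} → T (not a) → a ≡ false
T-not⇒≡false {false} _ = refl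

true≢false : ∀ {x y} → x ≡ true → y ≡ false → x ≢ y
true≢false refl refl ()

SeparatingTail : Bool → ℕ → ℕ → ℕ → Set
SeparatingTail b N i i′ =
  Σ[ p ∈ ℕ ] p < N × arcFromCentre b p ≡ false × 2 ≤ p × pathAdjacent i p ≢ pathAdjacent i′ p

-- Take a neighbour of one head that is not a neighbour of the other, keeping inside
-- the path and away from v₀, v₁.
separatingTail : ∀ b N → 6 ≤ N → ∀ i i′ → i < i′ → i′ < N →
  arcFromCentre b i ≡ true → arcFromCentre b i′ ≡ true → SeparatingTail b N i i′
separatingTail b N _ zero (suc zero) _ _ h h′ = case trans (sym h′) (cong not h) of λ ()
separatingTail b N 6≤N zero (suc (suc j)) _ i′<N _ h′ with 3 + j ℕ.<? N
... | yes 3+j<N = 3 + j , 3+j<N , cong not h′ , s≤s (s≤s z≤n) ,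
      ≢-sym (true≢false (pathAdjacent-suc (2 + j)) (pathAdjacent-far 0 (3 + j) (λ ()) (λ ())))
... | no 3+j≮N = 1 + j , ℕ.<-trans (ℕ.n<1+n _) i′<N , before-head-tail b (1 + j) h′ ,
      s≤s (ℕ.≤-trans (s≤s z≤n) 3≤j) ,
      ≢-sym (true≢false (pathAdjacent-pred (1 + j)) (pathAdjacent-far 0 (1 + j) (j≢0 ∘ ℕ.suc-injective) (λ ())))
  where
  3≤j : 3 ≤ j
  3≤j = ℕ.≤-pred (ℕ.≤-pred (ℕ.≤-pred (ℕ.≤-trans 6≤N (ℕ.≮⇒≥ 3+j≮N))))
  j≢0 : j ≢ 0
  j≢0 refl = case 3≤j of λ ()
separatingTail b N 6≤N (suc i) i′ i<i′ i′<N h h′ with i′ ℕ.≟ 2 + i | i′ ℕ.≟ 3 + i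
... | yes refl | _ = case trans (sym h′) (cong not h) of λ ()
... | no i′≢2+i | no i′≢3+i = 2 + i , ℕ.≤-<-trans (ℕ.<⇒≤ 2+i<i′) i′<N , cong not h , s≤s (s≤s z≤n) ,
      true≢false (pathAdjacent-suc (1 + i))
        (pathAdjacent-far i′ (2 + i) (ℕ.<⇒≢ (ℕ.<-trans 2+i<i′ (ℕ.n<1+n i′))) i′≢3+i)
  where
  2+i<i′ : 2 + i < i′
  2+i<i′ = ℕ.≤∧≢⇒< i<i′ (i′≢2+i ∘ sym)
... | no _ | yes refl with 4 + i ℕ.<? N
...   | yes 4+i<N = 4 + i , 4+i<N , cong not h′ , s≤s (s≤s z≤n) ,
        ≢-sym (true≢false (pathAdjacent-suc (3 + i))
          (pathAdjacent-far (1 + i) (4 + i) (≢-sym (n≢1+k+n 1 (2 + i))) (n≢1+k+n 3 (1 + i))))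
...   | no 4+i≮N = i , ℕ.<-trans (ℕ.<-trans (ℕ.n<1+n i) i<i′) i′<N ,
        before-head-tail b i h , 2≤i ,
        true≢false (pathAdjacent-pred i) (pathAdjacent-far (3 + i) i (n≢1+k+n 3 i) (≢-sym (n≢1+k+n 1 (1 + i))))
  where
  2≤i : 2 ≤ i
  2≤i = ℕ.≤-pred (ℕ.≤-pred (ℕ.≤-pred (ℕ.≤-pred (ℕ.≤-trans 6≤N (ℕ.≮⇒≥ 4+i≮N)))))

-- C3-simple orientations are canonical

canonical : ∀ {m n} → Bool → Arcs (FanV m n)
canonical b (inj₁ _) (inj₁ _) = false
canonical b (inj₁ _) (inj₂ j) = arcFromCentre b (toℕ j)
canonical b (inj₂ j) (inj₁ _) = not (arcFromCentre b (toℕ j))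
canonical b (inj₂ i) (inj₂ j) = arcFromCentre b (toℕ i) ∧ pathAdjacent (toℕ i) (toℕ j)

private
  oneWay⇒≡not : ∀ a c → (a ≡ true ⊎ c ≡ true) → ¬ (a ≡ true × c ≡ true) → c ≡ not a
  oneWay⇒≡not false false (inj₁ ()) _
  oneWay⇒≡not false false (inj₂ ()) _
  oneWay⇒≡not false true _ _ = refl
  oneWay⇒≡not true false _ _ = refl
  oneWay⇒≡not true true _ both = ⊥-elim (both (refl , refl))

  ¬true⇒false : ∀ a → ¬ (a ≡ true) → a ≡ false
  ¬true⇒false false _ = refl
  ¬true⇒false true a≢true = ⊥-elim (a≢true refl)

  cyclic⇒ : ∀ a e a′ →
    (a ≡ true × e ≡ true × not a′ ≡ true) ⊎ (not a ≡ true × not e ≡ true × a′ ≡ true) →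
    a′ ≡ not a × e ≡ a
  cyclic⇒ true true false (inj₁ _) = refl , refl
  cyclic⇒ false false true (inj₂ _) = refl , refl
  cyclic⇒ true true true (inj₁ (_ , _ , ()))
  cyclic⇒ false _ _ (inj₁ (() , _))
  cyclic⇒ true _ _ (inj₂ (() , _))
  cyclic⇒ false true _ (inj₂ (_ , () , _))
  cyclic⇒ false false false (inj₂ (_ , _ , ()))

module _ {m n : ℕ} {O : Arcs (FanV (suc m) (suc (suc n)))}
         (orientation : IsFanOrientation O) (c3 : C3Simple O) where

  private
    reverse : ∀ x y → FanEdge x y → O y x ≡ not (O x y)
    reverse x y e = oneWay⇒≡not (O x y) (O y x)
      (proj₁ (proj₂ (orientation x y)) e) (proj₂ (proj₂ (orientation x y)))

    nonEdge : ∀ x y → ¬ FanEdge x y → O x y ≡ false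
    nonEdge x y ¬e = ¬true⇒false (O x y) (λ a → ¬e (proj₁ (orientation x y) a))

    triangle : ∀ c i i′ → toℕ i′ ≡ suc (toℕ i) →
      O (inj₁ c) (inj₂ i′) ≡ not (O (inj₁ c) (inj₂ i)) × O (inj₂ i) (inj₂ i′) ≡ O (inj₁ c) (inj₂ i)
    triangle c i i′ i′≡1+i with c3 (inj₁ c) (inj₂ i) (inj₂ i′) tt (inj₁ i′≡1+i) tt
    ... | inj₁ (c→i , i→i′ , i′→c) = cyclic⇒ _ _ _
          (inj₁ (c→i , i→i′ , trans (sym (reverse (inj₁ c) (inj₂ i′) tt)) i′→c))
    ... | inj₂ (i→c , i′→i , c→i′) = cyclic⇒ _ _ _
          (inj₂ (trans (sym (reverse (inj₁ c) (inj₂ i) tt)) i→c ,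
                 trans (sym (reverse (inj₂ i) (inj₂ i′) (inj₁ i′≡1+i))) i′→i , c→i′))

    b : Bool
    b = O (inj₁ fz) (inj₂ fz)

    centre→v₀ : ∀ c → O (inj₁ c) (inj₂ fz) ≡ b
    centre→v₀ c = trans (sym (proj₂ (triangle c fz (fs fz) refl))) (proj₂ (triangle fz fz (fs fz) refl))

    centre→vₖ : ∀ c k (k<N : k < suc (suc n)) → O (inj₁ c) (inj₂ (fromℕ< k<N)) ≡ arcFromCentre b k
    centre→vₖ c zero _ = centre→v₀ c
    centre→vₖ c (suc k) k+1<N =
      trans (proj₁ (triangle c (fromℕ< k<N) (fromℕ< k+1<N) consecutive)) (cong not (centre→vₖ c k k<N))
      where
      k<N : k < suc (suc n)
      k<N = ℕ.<-trans (ℕ.n<1+n k) k+1<N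
      consecutive : toℕ (fromℕ< k+1<N) ≡ suc (toℕ (fromℕ< k<N))
      consecutive = trans (toℕ-fromℕ< k+1<N) (cong suc (sym (toℕ-fromℕ< k<N)))

    centre→path : ∀ c j → O (inj₁ c) (inj₂ j) ≡ arcFromCentre b (toℕ j)
    centre→path c j = subst (λ j′ → O (inj₁ c) (inj₂ j′) ≡ arcFromCentre b (toℕ j))
      (fromℕ<-toℕ j (toℕ<n j)) (centre→vₖ c (toℕ j) (toℕ<n j))

  C3Simple⇒canonical : ∃[ b ] O ≗ᴬ canonical b
  C3Simple⇒canonical = b , agree
    where
    agree : O ≗ᴬ canonical b
    agree (inj₁ c) (inj₁ c′) = nonEdge (inj₁ c) (inj₁ c′) (λ ())
    agree (inj₁ c) (inj₂ j) = centre→path c j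
    agree (inj₂ j) (inj₁ c) = trans (reverse (inj₁ c) (inj₂ j) tt) (cong not (centre→path c j))
    agree (inj₂ i) (inj₂ j) with toℕ j ≡ᵇ suc (toℕ i) in j≡1+i | toℕ i ≡ᵇ suc (toℕ j) in i≡1+j
    ... | true | _ = begin
      O (inj₂ i) (inj₂ j)               ≡⟨ proj₂ (triangle fz i j (≡ᵇ-true⇒≡ j≡1+i)) ⟩
      O (inj₁ fz) (inj₂ i)              ≡⟨ centre→path fz i ⟩
      arcFromCentre b (toℕ i)           ≡⟨ ∧-identityʳ _ ⟨
      arcFromCentre b (toℕ i) ∧ true    ∎
      where open ≡-Reasoning
    ... | false | true = begin
      O (inj₂ i) (inj₂ j)               ≡⟨ reverse (inj₂ j) (inj₂ i) (inj₁ i≡1+j′) ⟩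
      not (O (inj₂ j) (inj₂ i))         ≡⟨ cong not (proj₂ (triangle fz j i i≡1+j′)) ⟩
      not (O (inj₁ fz) (inj₂ j))        ≡⟨ cong not (centre→path fz j) ⟩
      arcFromCentre b (suc (toℕ j))     ≡⟨ cong (arcFromCentre b) i≡1+j′ ⟨
      arcFromCentre b (toℕ i)           ≡⟨ ∧-identityʳ _ ⟨
      arcFromCentre b (toℕ i) ∧ true    ∎
      where
      open ≡-Reasoning
      i≡1+j′ : toℕ i ≡ suc (toℕ j)
      i≡1+j′ = ≡ᵇ-true⇒≡ {toℕ i} i≡1+j
    ... | false | false = trans (nonEdge (inj₂ i) (inj₂ j) notAdjacent) (sym (∧-zeroʳ _))
      where
      notAdjacent : ¬ FanEdge {suc m} {suc (suc n)} (inj₂ i) (inj₂ j)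
      notAdjacent (inj₁ e) = ≡ᵇ-false⇒≢ {toℕ j} j≡1+i e
      notAdjacent (inj₂ e) = ≡ᵇ-false⇒≢ {toℕ i} i≡1+j e

-- Layers of a canonical orientation

-- Arcs go centre → head → tail → centre.
data Layer : Set where
  centre head tail : Layer

next : Layer → Layer
next centre = head
next head = tail
next tail = centre

prev : Layer → Layer
prev centre = tail
prev head = centre
prev tail = head

prev-next : ∀ L → prev (next L) ≡ L
prev-next centre = refl
prev-next head = refl
prev-next tail = refl

next^ : ℕ → Layer → Layer
next^ zero L = L
next^ (suc k) L = next^ k (next L)

prev^ : ℕ → Layer → Layer
prev^ zero L = L
prev^ (suc k) L = prev (prev^ k L)

prev^-next^ : ∀ k L → prev^ k (next^ k L) ≡ L
prev^-next^ zero L = refl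
prev^-next^ (suc k) L = trans (cong prev (prev^-next^ k (next L))) (prev-next L)

pathLayer : Bool → Layer
pathLayer true = head
pathLayer false = tail

-- steps X Y is the least positive k with next^ k X ≡ Y.
steps : Layer → Layer → ℕ
steps centre centre = 3
steps centre head = 1
steps centre tail = 2
steps head centre = 2
steps head head = 3
steps head tail = 1
steps tail centre = 1
steps tail head = 2
steps tail tail = 3

steps≤3 : ∀ X Y → steps X Y ≤ 3
steps≤3 centre centre = ℕ.≤-refl
steps≤3 centre head = s≤s z≤n
steps≤3 centre tail = s≤s (s≤s z≤n)
steps≤3 head centre = s≤s (s≤s z≤n)
steps≤3 head head = ℕ.≤-refl
steps≤3 head tail = s≤s z≤n
steps≤3 tail centre = s≤s z≤n
steps≤3 tail head = s≤s (s≤s z≤n)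
steps≤3 tail tail = ℕ.≤-refl

fewer-steps : ∀ X k → 0 < k → ¬ (k < steps X (next^ k X))
fewer-steps centre 1 _ (s≤s ())
fewer-steps head 1 _ (s≤s ())
fewer-steps tail 1 _ (s≤s ())
fewer-steps centre 2 _ (s≤s (s≤s ()))
fewer-steps head 2 _ (s≤s (s≤s ()))
fewer-steps tail 2 _ (s≤s (s≤s ()))
fewer-steps X (suc (suc (suc k))) _ 3+k<steps with ℕ.≤-trans 3+k<steps (steps≤3 X _)
... | s≤s (s≤s (s≤s ()))

-- Distances and resolving sets in a canonical orientation

if-1-4-injective : ∀ {a c} → (if a then 1 else 4) ≡ (if c then 1 else 4) → a ≡ c
if-1-4-injective {true} {true} _ = refl
if-1-4-injective {false} {false} _ = refl

module Canonical (m n : ℕ) (b : Bool) where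

  M N : ℕ
  M = suc m
  N = suc (suc n)

  Vertex : Set
  Vertex = FanV M N

  D : Arcs Vertex
  D = canonical b

  isHead : Fin N → Bool
  isHead j = arcFromCentre b (toℕ j)

  layer : Vertex → Layer
  layer (inj₁ _) = centre
  layer (inj₂ j) = pathLayer (isHead j)

  arc-layer : ∀ x y → D x y ≡ true → layer y ≡ next (layer x)
  arc-layer (inj₁ _) (inj₁ _) ()
  arc-layer (inj₁ _) (inj₂ j) a rewrite a = refl
  arc-layer (inj₂ j) (inj₁ _) a with isHead j
  arc-layer (inj₂ j) (inj₁ _) () | true
  ... | false = refl
  arc-layer (inj₂ i) (inj₂ j) a with isHead i in hi
  ... | true rewrite pathAdjacent⇒arcFromCentre b (toℕ i) (toℕ j) a | hi = refl

  Walk-layer : ∀ {k x y} → Walk D k x y → layer y ≡ next^ k (layer x)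
  Walk-layer here = refl
  Walk-layer {suc k} {x} (step {w = w} a wk) = trans (Walk-layer wk) (cong (next^ k) (arc-layer x w a))

  Walk-layer⁻ : ∀ {k x y} → Walk D k x y → layer x ≡ prev^ k (layer y)
  Walk-layer⁻ {k} {x} wk = trans (sym (prev^-next^ k (layer x))) (cong (prev^ k) (sym (Walk-layer wk)))

  noWalk : ∀ {k x y} → layer y ≢ next^ k (layer x) → ¬ Walk D k x y
  noWalk wrong wk = wrong (Walk-layer wk)

  neighbour : (j : Fin N) → Σ[ j′ ∈ Fin N ] pathAdjacent (toℕ j) (toℕ j′) ≡ true
  neighbour fz = fs fz , refl
  neighbour (fs j) = inject₁ j ,
    subst (λ k → pathAdjacent (suc (toℕ j)) k ≡ true) (sym (toℕ-inject₁ j)) (pathAdjacent-pred (toℕ j))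

  centre→head : ∀ c j → isHead j ≡ true → D (inj₁ c) (inj₂ j) ≡ true
  centre→head c j h = h

  tail→centre : ∀ j c → isHead j ≡ false → D (inj₂ j) (inj₁ c) ≡ true
  tail→centre j c t rewrite t = refl

  head→path : ∀ i j → isHead i ≡ true → pathAdjacent (toℕ i) (toℕ j) ≡ true → D (inj₂ i) (inj₂ j) ≡ true
  head→path i j h adj rewrite h | adj = refl

  head⇝centre : ∀ i c → isHead i ≡ true → Walk D 2 (inj₂ i) (inj₁ c)
  head⇝centre i c h = step {w = inj₂ j} (head→path i j h adj) (arc⇒Walk (tail→centre j c j-tail))
    where
    j : Fin N
    j = proj₁ (neighbour i)
    adj : pathAdjacent (toℕ i) (toℕ j) ≡ true
    adj = proj₂ (neighbour i)
    j-tail : isHead j ≡ false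
    j-tail = trans (pathAdjacent⇒arcFromCentre b (toℕ i) (toℕ j) adj) (cong not h)

  centre⇝tail : ∀ c j → isHead j ≡ false → Walk D 2 (inj₁ c) (inj₂ j)
  centre⇝tail c j t = step {w = inj₂ i} (centre→head c i i-head) (arc⇒Walk (head→path i j i-head adj))
    where
    i : Fin N
    i = proj₁ (neighbour j)
    i-head : isHead i ≡ true
    i-head = trans (pathAdjacent⇒arcFromCentre b (toℕ j) (toℕ i) (proj₂ (neighbour j))) (cong not t)
    adj : pathAdjacent (toℕ i) (toℕ j) ≡ true
    adj = trans (pathAdjacent-sym (toℕ i) (toℕ j)) (proj₂ (neighbour j))

  someHead : Σ[ j ∈ Fin N ] isHead j ≡ true
  someHead = arcFromCentre-someTrue b n

  _≟ᵛ_ : DecidableEquality Vertex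
  _≟ᵛ_ = ≡-dec _≟ᶠ_ _≟ᶠ_

  shorter-walks : ∀ {x y X Y} → x ≢ y → layer x ≡ X → layer y ≡ Y → ∀ k → k < steps X Y → ¬ Walk D k x y
  shorter-walks x≢y _ _ zero _ w = x≢y (Walk-zero⇒≡ w)
  shorter-walks {X = X} x≢y refl refl (suc k) k<steps w =
    fewer-steps X (suc k) (s≤s z≤n) (subst (λ Y → suc k < steps X Y) (Walk-layer w) k<steps)

  -- Distinct vertices are as far apart as their layers, except that from a head
  -- to a non-adjacent tail one must go round through a centre.
  detour : Vertex → Vertex → ℕ
  detour (inj₂ i) (inj₂ j) = if isHead i ∧ not (isHead j) ∧ not (pathAdjacent (toℕ i) (toℕ j)) then 3 else 0
  detour _ _ = 0

  dist : Vertex → Vertex → ℕ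
  dist x y with x ≟ᵛ y
  ... | yes _ = 0
  ... | no _ = steps (layer x) (layer y) + detour x y

  head-detour-tail : ∀ i j → isHead i ≡ true → isHead j ≡ false → pathAdjacent (toℕ i) (toℕ j) ≡ false →
    Dist D (inj₂ i) (inj₂ j) 4
  head-detour-tail i j hi tj ¬adj = head⇝centre i fz hi ++ʷ centre⇝tail fz j tj , shorter
    where
    shorter : ∀ k → k < 4 → ¬ Walk D k (inj₂ i) (inj₂ j)
    shorter 0 _ w with Walk-zero⇒≡ w
    ... | refl = case trans (sym hi) tj of λ ()
    shorter 1 _ (step a here) = case trans (sym ¬adj) (trans (sym (cong (_∧ pathAdjacent (toℕ i) (toℕ j)) hi)) a) of λ ()
    shorter 2 _ = noWalk (subst₂ (λ X Y → Y ≢ next^ 2 X) (cong pathLayer (sym hi)) (cong pathLayer (sym tj)) λ ())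
    shorter 3 _ = noWalk (subst₂ (λ X Y → Y ≢ next^ 3 X) (cong pathLayer (sym hi)) (cong pathLayer (sym tj)) λ ())
    shorter (suc (suc (suc (suc k)))) (s≤s (s≤s (s≤s (s≤s ()))))

  distinct-Dist : ∀ x y → x ≢ y → Dist D x y (steps (layer x) (layer y) + detour x y)
  distinct-Dist (inj₁ c) (inj₁ c′) x≢y =
    arc⇒Walk (centre→head c t t-head) ++ʷ head⇝centre t c′ t-head , shorter-walks x≢y refl refl
    where
    t : Fin N
    t = proj₁ someHead
    t-head : isHead t ≡ true
    t-head = proj₂ someHead
  distinct-Dist (inj₁ c) (inj₂ j) x≢y with isHead j in hj
  ... | true = arc⇒Walk hj , shorter-walks x≢y refl (cong pathLayer hj)
  ... | false = centre⇝tail c j hj , shorter-walks x≢y refl (cong pathLayer hj)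
  distinct-Dist (inj₂ j) (inj₁ c) x≢y with isHead j in hj
  ... | true = head⇝centre j c hj , shorter-walks x≢y (cong pathLayer hj) refl
  ... | false = arc⇒Walk (tail→centre j c hj) , shorter-walks x≢y (cong pathLayer hj) refl
  distinct-Dist (inj₂ i) (inj₂ j) x≢y with isHead i in hi | isHead j in hj
  ... | true | true = head⇝centre i fz hi ++ʷ arc⇒Walk hj , shorter-walks x≢y (cong pathLayer hi) (cong pathLayer hj)
  ... | false | true = arc⇒Walk {y = inj₁ fz} (tail→centre i fz hi) ++ʷ arc⇒Walk hj ,
                        shorter-walks x≢y (cong pathLayer hi) (cong pathLayer hj)
  ... | false | false = arc⇒Walk (tail→centre i fz hi) ++ʷ centre⇝tail fz j hj ,
                         shorter-walks x≢y (cong pathLayer hi) (cong pathLayer hj)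
  ... | true | false with pathAdjacent (toℕ i) (toℕ j) in adj
  ...   | true = arc⇒Walk (head→path i j hi adj) , shorter-walks x≢y (cong pathLayer hi) (cong pathLayer hj)
  ...   | false = head-detour-tail i j hi hj adj

  dist-Dist : ∀ x y → Dist D x y (dist x y)
  dist-Dist x y with x ≟ᵛ y
  ... | yes refl = Dist-refl x
  ... | no x≢y = distinct-Dist x y x≢y

  open DistanceFunction dist dist-Dist public

  dist-layer : ∀ x y → layer x ≡ prev^ (dist x y) (layer y)
  dist-layer x y = Walk-layer⁻ (proj₁ (dist-Dist x y))

  centres-twins : ∀ c c′ y → inj₁ c ≢ y → inj₁ c′ ≢ y → dist (inj₁ c) y ≡ dist (inj₁ c′) y
  centres-twins c c′ y c≢y c′≢y with inj₁ c ≟ᵛ y | inj₁ c′ ≟ᵛ y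
  ... | yes c≡y | _ = ⊥-elim (c≢y c≡y)
  ... | no _ | yes c′≡y = ⊥-elim (c′≢y c′≡y)
  ... | no _ | no _ = refl

  detour-from-tail : ∀ s → isHead s ≡ false → ∀ y → detour (inj₂ s) y ≡ 0
  detour-from-tail s ts (inj₁ _) = refl
  detour-from-tail s ts (inj₂ _) rewrite ts = refl

  tails-twins : ∀ s s′ y → isHead s ≡ false → isHead s′ ≡ false → inj₂ s ≢ y → inj₂ s′ ≢ y →
    dist (inj₂ s) y ≡ dist (inj₂ s′) y
  tails-twins s s′ y ts ts′ s≢y s′≢y with inj₂ s ≟ᵛ y | inj₂ s′ ≟ᵛ y
  ... | yes s≡y | _ = ⊥-elim (s≢y s≡y)
  ... | no _ | yes s′≡y = ⊥-elim (s′≢y s′≡y)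
  ... | no _ | no _ rewrite detour-from-tail s ts y | detour-from-tail s′ ts′ y | ts | ts′ = refl

  dist-head-tail : ∀ t s → isHead t ≡ true → isHead s ≡ false →
    dist (inj₂ t) (inj₂ s) ≡ (if pathAdjacent (toℕ t) (toℕ s) then 1 else 4)
  dist-head-tail t s ht ts with inj₂ t ≟ᵛ inj₂ s
  ... | yes refl = case trans (sym ht) ts of λ ()
  ... | no _ rewrite ht | ts with pathAdjacent (toℕ t) (toℕ s)
  ... | true = refl
  ... | false = refl

  open import Data.List.Membership.DecPropositional _≟ᵛ_ public using (_∈?_)

  otherCentres : List Vertex
  otherCentres = map (λ c → inj₁ (fs c)) (allFin m)

  withPath : List (Fin N) → List Vertex
  withPath P = otherCentres ++ map inj₂ P

  length-withPath : ∀ P → length (withPath P) ≡ m + length P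
  length-withPath P = trans (length-++ otherCentres)
    (cong₂ _+_ (trans (length-map _ (allFin m)) (length-tabulate {n = m} (λ c → c))) (length-map inj₂ P))

  withPath-Unique : ∀ {P} → Unique P → Unique (withPath P)
  withPath-Unique uniqueP =
    ++⁺ (map⁺ (λ eq → suc-injective (inj₁-injective eq)) (allFin⁺ m)) (map⁺ inj₂-injective uniqueP) disjoint
    where
    disjoint : ∀ {v} → ¬ (v ∈ otherCentres × v ∈ map inj₂ _)
    disjoint (p , q) with ∈-map⁻ _ p | ∈-map⁻ inj₂ q
    ... | _ , _ , refl | _ , _ , ()

  AtMostOneTailOutside : List (Fin N) → Set
  AtMostOneTailOutside P =
    ∀ s s′ → isHead s ≡ false → isHead s′ ≡ false → s ∉ P → s′ ∉ P → s ≡ s′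

  HeadsSeparated : List (Fin N) → Set
  HeadsSeparated P = ∀ t t′ → isHead t ≡ true → isHead t′ ≡ true → t ∉ P → t′ ∉ P → t ≢ t′ →
    Σ[ s ∈ Fin N ] s ∈ P × isHead s ≡ false × pathAdjacent (toℕ t) (toℕ s) ≢ pathAdjacent (toℕ t′) (toℕ s)

  agreement⇒same-layer : ∀ {B u v} → B ≢ [] → (∀ y → y ∈ B → dist u y ≡ dist v y) → layer u ≡ layer v
  agreement⇒same-layer {B} {u} {v} B≢[] same = begin
    layer u                       ≡⟨ dist-layer u y ⟩
    prev^ (dist u y) (layer y)    ≡⟨ cong (λ k → prev^ k (layer y)) (same y y∈B) ⟩
    prev^ (dist v y) (layer y)    ≡⟨ dist-layer v y ⟨
    layer v                       ∎
    where
    open ≡-Reasoning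
    y : Vertex
    y = proj₁ (nonempty⇒member B B≢[])
    y∈B : y ∈ B
    y∈B = proj₂ (nonempty⇒member B B≢[])

  module _ (P : List (Fin N)) (tailsOK : AtMostOneTailOutside P) (headsOK : HeadsSeparated P) where

    private
      inB : ∀ {j} → j ∈ P → inj₂ j ∈ withPath P
      inB j∈P = ∈-++⁺ʳ otherCentres (∈-map⁺ inj₂ j∈P)

      otherCentre∈B : ∀ c → inj₁ (fs c) ∈ withPath P
      otherCentre∈B c = ∈-++⁺ˡ (∈-map⁺ (λ c → inj₁ (fs c)) (∈-allFin c))

    withPath-separates-outside : ∀ x y → x ≢ y → x ∉ withPath P → y ∉ withPath P → layer x ≡ layer y →
      (∀ z → z ∈ withPath P → dist x z ≡ dist y z) → x ≡ y
    withPath-separates-outside (inj₁ fz) (inj₁ fz) _ _ _ _ _ = refl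
    withPath-separates-outside (inj₁ (fs c)) _ _ x∉B _ _ _ = ⊥-elim (x∉B (otherCentre∈B c))
    withPath-separates-outside (inj₁ fz) (inj₁ (fs c)) _ _ y∉B _ _ = ⊥-elim (y∉B (otherCentre∈B c))
    withPath-separates-outside (inj₁ _) (inj₂ j) _ _ _ layers _ with isHead j
    ... | true = case layers of λ ()
    ... | false = case layers of λ ()
    withPath-separates-outside (inj₂ j) (inj₁ _) _ _ _ layers _ with isHead j
    ... | true = case layers of λ ()
    ... | false = case layers of λ ()
    withPath-separates-outside (inj₂ i) (inj₂ j) i≢j i∉B j∉B layers same with isHead i in hi | isHead j in hj
    ... | false | false = cong inj₂ (tailsOK i j hi hj (i∉B ∘ inB) (j∉B ∘ inB))
    ... | true | false = case layers of λ ()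
    ... | false | true = case layers of λ ()
    ... | true | true with headsOK i j hi hj (i∉B ∘ inB) (j∉B ∘ inB) (i≢j ∘ cong inj₂)
    ...   | s , s∈P , ts , adjacencies = ⊥-elim (adjacencies (if-1-4-injective (begin
            (if pathAdjacent (toℕ i) (toℕ s) then 1 else 4)  ≡⟨ dist-head-tail i s hi ts ⟨
            dist (inj₂ i) (inj₂ s)                            ≡⟨ same (inj₂ s) (inB s∈P) ⟩
            dist (inj₂ j) (inj₂ s)                            ≡⟨ dist-head-tail j s hj ts ⟩
            (if pathAdjacent (toℕ j) (toℕ s) then 1 else 4)  ∎)))
      where open ≡-Reasoning

    withPath-Resolving : Unique P → withPath P ≢ [] → Resolving D (withPath P)
    withPath-Resolving uniqueP B≢[] = B≢[] , withPath-Unique uniqueP , resolve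
      where
      resolve : ∀ u v → SameRep D (withPath P) u v → u ≡ v
      resolve u v rep with u ≟ᵛ v | u ∈? withPath P | v ∈? withPath P
      ... | yes u≡v | _ | _ = u≡v
      ... | no _ | yes u∈B | _ = sym (agree-at-member⇒≡ (λ y y∈B → sym (SameRep⇒≡ rep y y∈B)) u∈B)
      ... | no _ | no _ | yes v∈B = agree-at-member⇒≡ (SameRep⇒≡ rep) v∈B
      ... | no u≢v | no u∉B | no v∉B = withPath-separates-outside u v u≢v u∉B v∉B
            (agreement⇒same-layer {u = u} {v} B≢[] (SameRep⇒≡ rep)) (SameRep⇒≡ rep)

  open Counting _≟ᵛ_ public

  centres : List Vertex
  centres = map inj₁ (allFin M)

  tailIndices : List (Fin N)
  tailIndices = filterᵇ (not ∘ isHead) (allFin N)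

  tails : List Vertex
  tails = map inj₂ tailIndices

  length-tails : length tails ≡ tailsBelow b N
  length-tails = trans (length-map inj₂ tailIndices)
    (length-filterᵇ-tabulate (not ∘ isHead) (not ∘ arcFromCentre b) N (λ j → j) (λ _ → refl))

  centres-Unique : Unique centres
  centres-Unique = map⁺ inj₁-injective (allFin⁺ M)

  tails-Unique : Unique tails
  tails-Unique = map⁺ inj₂-injective (filter⁺ (T? ∘ not ∘ isHead) (allFin⁺ N))

  ∈-tails⁻ : ∀ {x} → x ∈ tails → Σ[ s ∈ Fin N ] x ≡ inj₂ s × isHead s ≡ false
  ∈-tails⁻ x∈tails with ∈-map⁻ inj₂ x∈tails
  ... | s , s∈ , refl = s , refl , T-not⇒≡false (proj₂ (∈-filter⁻ (T? ∘ not ∘ isHead) {xs = allFin N} s∈))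

  AllHeads : List Vertex → Set
  AllHeads L = ∀ {x} → x ∈ L → Σ[ t ∈ Fin N ] x ≡ inj₂ t × isHead t ≡ true

  module _ {B : List Vertex} (resolving : Resolving D B) where

    centres-inside : m ≤ countIn B centres
    centres-inside = ℕ.≤-pred (subst (_≤ suc (countIn B centres)) length-centres
      (length≤1+countIn B centres-Unique twins))
      where
      length-centres : length centres ≡ M
      length-centres = trans (length-map inj₁ (allFin M)) (length-tabulate {n = M} (λ c → c))
      twins : ∀ {x y} → x ∈ centres → y ∈ centres → x ∉ B → y ∉ B → x ≡ y
      twins x∈ y∈ x∉B y∉B with ∈-map⁻ inj₁ x∈ | ∈-map⁻ inj₁ y∈
      ... | c , _ , refl | c′ , _ , refl =
        resolves resolving _ _ (λ z z∈B → centres-twins c c′ z (∉⇒≢ x∉B z∈B) (∉⇒≢ y∉B z∈B))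

    tails-inside : tailsBelow b N ≤ suc (countIn B tails)
    tails-inside = subst (_≤ suc (countIn B tails)) length-tails
      (length≤1+countIn B tails-Unique twins)
      where
      twins : ∀ {x y} → x ∈ tails → y ∈ tails → x ∉ B → y ∉ B → x ≡ y
      twins x∈ y∈ x∉B y∉B with ∈-tails⁻ x∈ | ∈-tails⁻ y∈
      ... | s , refl , ts | s′ , refl , ts′ =
        resolves resolving _ _ (λ z z∈B → tails-twins s s′ z ts ts′ (∉⇒≢ x∉B z∈B) (∉⇒≢ y∉B z∈B))

    lower-bound : ∀ Hs → Unique Hs → AllHeads Hs → ∀ k → k ≤ countIn B tails →
      m + (k + countIn B Hs) ≤ length B
    lower-bound Hs uniqueHs heads k k≤ = ℕ.≤-trans
      (ℕ.+-mono-≤ centres-inside (ℕ.+-monoˡ-≤ (countIn B Hs) k≤))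
      (subst (_≤ length B) split (countIn≤length B (++⁺ centres-Unique (++⁺ tails-Unique uniqueHs tails∩Hs) centres∩rest)))
      where
      split : countIn B (centres ++ tails ++ Hs) ≡ countIn B centres + (countIn B tails + countIn B Hs)
      split = trans (countIn-++ B centres (tails ++ Hs)) (cong (countIn B centres +_) (countIn-++ B tails Hs))
      tails∩Hs : ∀ {v} → ¬ (v ∈ tails × v ∈ Hs)
      tails∩Hs (p , q) with ∈-tails⁻ p | heads q
      ... | s , refl , ts | t , refl , ht = case trans (sym ts) ht of λ ()
      centres∩rest : ∀ {v} → ¬ (v ∈ centres × v ∈ tails ++ Hs)
      centres∩rest (p , q) with ∈-map⁻ inj₁ p | ∈-++⁻ tails q
      ... | _ , _ , refl | inj₁ q′ = case proj₁ (proj₂ (∈-tails⁻ q′)) of λ ()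
      ... | _ , _ , refl | inj₂ q′ = case proj₁ (proj₂ (heads q′)) of λ ()

  general-lower-bound : ∀ {B} → Resolving D B → m + tailsBelow b n ≤ length B
  general-lower-bound {B} resolving = subst (λ k → m + k ≤ length B) (ℕ.+-identityʳ _)
    (lower-bound resolving [] [] (λ ()) (tailsBelow b n) tails-beyond-first-two)
    where
    tails-beyond-first-two : tailsBelow b n ≤ countIn B tails
    tails-beyond-first-two = ℕ.≤-pred (subst (_≤ suc (countIn B tails)) (tailsBelow-+2 b n) (tails-inside resolving))

  twin-heads-lower-bound : ∀ {B} → Resolving D B → ∀ t t′ → isHead t ≡ true → isHead t′ ≡ true → t ≢ t′ →
    (inj₂ t ∉ B → inj₂ t′ ∉ B → ∀ y → y ∈ B → dist (inj₂ t) y ≡ dist (inj₂ t′) y) →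
    ∀ k → k ≤ countIn B tails → m + (k + 1) ≤ length B
  twin-heads-lower-bound {B} resolving t t′ ht ht′ t≢t′ twins k k≤ =
    ℕ.≤-trans (ℕ.+-monoʳ-≤ m (ℕ.+-monoʳ-≤ k one-inside)) (lower-bound resolving pair uniquePair heads k k≤)
    where
    pair : List Vertex
    pair = inj₂ t ∷ inj₂ t′ ∷ []
    uniquePair : Unique pair
    uniquePair = (t≢t′ ∘ inj₂-injective ∷ []) ∷ [] ∷ []
    heads : AllHeads pair
    heads (here refl) = t , refl , ht
    heads (there (here refl)) = t′ , refl , ht′
    oneOutside : ∀ {x y} → x ∈ pair → y ∈ pair → x ∉ B → y ∉ B → x ≡ y
    oneOutside (here refl) (here refl) _ _ = refl
    oneOutside (there (here refl)) (there (here refl)) _ _ = refl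
    oneOutside (here refl) (there (here refl)) x∉B y∉B = resolves resolving _ _ (twins x∉B y∉B)
    oneOutside (there (here refl)) (here refl) x∉B y∉B = resolves resolving _ _ (λ y y∈B → sym (twins y∉B x∉B y y∈B))
    one-inside : 1 ≤ countIn B pair
    one-inside = ℕ.≤-pred (length≤1+countIn B uniquePair oneOutside)

  withPath-MetricDim : ∀ P → Unique P → AtMostOneTailOutside P → HeadsSeparated P → 0 < m + length P →
    (∀ B → Resolving D B → m + length P ≤ length B) → MetricDim D (m + length P)
  withPath-MetricDim P uniqueP tailsOK headsOK positive minimal =
    stronglyConnected ,
    (withPath P , withPath-Resolving P tailsOK headsOK uniqueP nonempty , length-withPath P) ,
    minimal
    where
    nonempty : withPath P ≢ []
    nonempty B≡[] = ℕ.<⇒≢ positive (sym (trans (sym (length-withPath P)) (cong length B≡[])))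

  isLaterTail : Fin N → Bool
  isLaterTail j = (2 ≤ᵇ toℕ j) ∧ not (isHead j)

  laterTailIndices : List (Fin N)
  laterTailIndices = filterᵇ isLaterTail (allFin N)

  length-laterTails : length laterTailIndices ≡ tailsBelow b n
  length-laterTails =
    trans (length-filterᵇ-tabulate isLaterTail (λ k → (2 ≤ᵇ k) ∧ not (arcFromCentre b k)) N (λ j → j) (λ _ → refl))
          (count-cong n (λ k → cong not (not-involutive (arcFromCentre b k))))

  ∈-laterTails⁺ : ∀ {j} → 2 ≤ toℕ j → isHead j ≡ false → j ∈ laterTailIndices
  ∈-laterTails⁺ {j} 2≤j tj = ∈-filter⁺ (T? ∘ isLaterTail) (∈-allFin j)
    (Equivalence.from T-∧ (ℕ.≤⇒≤ᵇ 2≤j , subst (T ∘ not) (sym tj) tt))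

  laterTails-oneOutside : AtMostOneTailOutside laterTailIndices
  laterTails-oneOutside s s′ ts ts′ s∉ s′∉ =
    toℕ-injective (first-two-tails b (toℕ s) (toℕ s′) (below2 s ts s∉) (below2 s′ ts′ s′∉) ts ts′)
    where
    below2 : ∀ s → isHead s ≡ false → s ∉ laterTailIndices → toℕ s < 2
    below2 s ts s∉ = ℕ.≰⇒> (λ 2≤s → s∉ (∈-laterTails⁺ 2≤s ts))

  separatingIndex : ∀ {t t′ : Fin N} → SeparatingTail b N (toℕ t) (toℕ t′) →
    Σ[ s ∈ Fin N ] s ∈ laterTailIndices × isHead s ≡ false × pathAdjacent (toℕ t) (toℕ s) ≢ pathAdjacent (toℕ t′) (toℕ s)
  separatingIndex (p , p<N , tp , 2≤p , separates) rewrite sym (toℕ-fromℕ< p<N) =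
    fromℕ< p<N , ∈-laterTails⁺ 2≤p tp , tp , separates

  laterTails-separate : 4 ≤ n → HeadsSeparated laterTailIndices
  laterTails-separate 4≤n t t′ ht ht′ _ _ t≢t′ with ℕ.<-cmp (toℕ t) (toℕ t′)
  ... | tri< t<t′ _ _ = separatingIndex (separatingTail b N (s≤s (s≤s 4≤n)) (toℕ t) (toℕ t′) t<t′ (toℕ<n t′) ht ht′)
  ... | tri≈ _ t≡t′ _ = ⊥-elim (t≢t′ (toℕ-injective t≡t′))
  ... | tri> _ _ t′<t with separatingTail b N (s≤s (s≤s 4≤n)) (toℕ t′) (toℕ t) t′<t (toℕ<n t) ht′ ht
  ...   | p , p<N , tp , 2≤p , separates = separatingIndex (p , p<N , tp , 2≤p , ≢-sym separates)

  metricDim-large : 4 ≤ n → MetricDim D (m + tailsBelow b n)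
  metricDim-large 4≤n = subst (MetricDim D ∘ (m +_)) length-laterTails
    (withPath-MetricDim laterTailIndices (filter⁺ (T? ∘ isLaterTail) (allFin⁺ N))
      laterTails-oneOutside (laterTails-separate 4≤n) positive
      (λ B res → subst (λ k → m + k ≤ length B) (sym length-laterTails) (general-lower-bound res)))
    where
    positive : 0 < m + length laterTailIndices
    positive = subst (λ k → 0 < m + k) (sym length-laterTails)
      (ℕ.≤-trans (tailsBelow-positive b n (ℕ.≤-trans (s≤s (s≤s z≤n)) 4≤n)) (ℕ.m≤n+m _ m))

  -- Small paths: the resolving conditions on P are decided by evaluation

  open import Data.List.Membership.DecPropositional (_≟ᶠ_ {N}) using () renaming (_∈?_ to _∈ᶠ?_)

  atMostOneTailOutside? : ∀ P → Dec (AtMostOneTailOutside P)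
  atMostOneTailOutside? P = all? λ s → all? λ s′ →
    (isHead s ≟ᵇ false) →-dec (isHead s′ ≟ᵇ false) →-dec ¬? (s ∈ᶠ? P) →-dec ¬? (s′ ∈ᶠ? P) →-dec (s ≟ᶠ s′)

  headsSeparated? : ∀ P → Dec (HeadsSeparated P)
  headsSeparated? P = all? λ t → all? λ t′ →
    (isHead t ≟ᵇ true) →-dec (isHead t′ ≟ᵇ true) →-dec ¬? (t ∈ᶠ? P) →-dec ¬? (t′ ∈ᶠ? P) →-dec ¬? (t ≟ᶠ t′) →-dec
    any? λ s → (s ∈ᶠ? P) ×-dec (isHead s ≟ᵇ false) ×-dec ¬? (pathAdjacent (toℕ t) (toℕ s) ≟ᵇ pathAdjacent (toℕ t′) (toℕ s))

  withPath-MetricDim? : ∀ P → Unique P → {_ : True (atMostOneTailOutside? P)} → {_ : True (headsSeparated? P)} →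
    0 < m + length P → (∀ B → Resolving D B → m + length P ≤ length B) → MetricDim D (m + length P)
  withPath-MetricDim? P uniqueP {tailsOK} {headsOK} =
    withPath-MetricDim P uniqueP (toWitness tailsOK) (toWitness headsOK)

-- Small fans

metricDim-1-2 : ∀ b → MetricDim (canonical {1} {2} b) 1
metricDim-1-2 false = withPath-MetricDim? (fz ∷ []) ([] ∷ []) (s≤s z≤n) (λ B → Resolving⇒1≤length)
  where open Canonical 0 0 false
metricDim-1-2 true = withPath-MetricDim? (fz ∷ []) ([] ∷ []) (s≤s z≤n) (λ B → Resolving⇒1≤length)
  where open Canonical 0 0 true

metricDim-2 : ∀ m b → MetricDim (canonical {2 + m} {2} b) (suc m)
metricDim-2 m false = subst (MetricDim D) (ℕ.+-identityʳ (suc m))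
  (withPath-MetricDim? [] [] (s≤s z≤n) (λ B → general-lower-bound))
  where open Canonical (suc m) 0 false
metricDim-2 m true = subst (MetricDim D) (ℕ.+-identityʳ (suc m))
  (withPath-MetricDim? [] [] (s≤s z≤n) (λ B → general-lower-bound))
  where open Canonical (suc m) 0 true

module _ (m : ℕ) where

  open Canonical m 1 true

  private
    v₀ v₂ : Fin 3
    v₀ = fz
    v₂ = fs (fs fz)

  path-3-heads₀₂-twins : ∀ y → inj₂ v₀ ≢ y → inj₂ v₂ ≢ y → dist (inj₂ v₀) y ≡ dist (inj₂ v₂) y
  path-3-heads₀₂-twins (inj₁ _) _ _ = refl
  path-3-heads₀₂-twins (inj₂ fz) ≢v₀ _ = ⊥-elim (≢v₀ refl)
  path-3-heads₀₂-twins (inj₂ (fs fz)) _ _ = refl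
  path-3-heads₀₂-twins (inj₂ (fs (fs fz))) _ ≢v₂ = ⊥-elim (≢v₂ refl)

  path-3-lower-bound : ∀ B → Resolving D B → m + 1 ≤ length B
  path-3-lower-bound B res = twin-heads-lower-bound res v₀ v₂ refl refl (λ ())
    (λ v₀∉B v₂∉B y y∈B → path-3-heads₀₂-twins y (∉⇒≢ v₀∉B y∈B) (∉⇒≢ v₂∉B y∈B)) 0 z≤n

metricDim-3 : ∀ m b → MetricDim (canonical {suc m} {3} b) (suc m)
metricDim-3 m false = subst (MetricDim D) (ℕ.+-comm m 1)
  (withPath-MetricDim? (fz ∷ []) ([] ∷ []) (ℕ.m≤n+m 1 m) (λ B → general-lower-bound))
  where open Canonical m 1 false
metricDim-3 m true = subst (MetricDim D) (ℕ.+-comm m 1)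
  (withPath-MetricDim? (fz ∷ []) ([] ∷ []) (ℕ.m≤n+m 1 m) (path-3-lower-bound m))
  where open Canonical m 1 true

metricDim-4 : ∀ m b → MetricDim (canonical {suc m} {4} b) (suc m)
metricDim-4 m false = subst (MetricDim D) (ℕ.+-comm m 1)
  (withPath-MetricDim? (fz ∷ []) ([] ∷ []) (ℕ.m≤n+m 1 m) (λ B → general-lower-bound))
  where open Canonical m 2 false
metricDim-4 m true = subst (MetricDim D) (ℕ.+-comm m 1)
  (withPath-MetricDim? (fs (fs (fs fz)) ∷ []) ([] ∷ []) (ℕ.m≤n+m 1 m) (λ B → general-lower-bound))
  where open Canonical m 2 true

module _ (m : ℕ) where

  open Canonical m 3 true

  private
    v₀ v₁ v₂ v₃ v₄ : Fin 5
    v₀ = fz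
    v₁ = fs fz
    v₂ = fs (fs fz)
    v₃ = fs (fs (fs fz))
    v₄ = fs (fs (fs (fs fz)))

  path-5-heads₂₄-twins : ∀ y → inj₂ v₁ ≢ y → inj₂ v₂ ≢ y → inj₂ v₄ ≢ y → dist (inj₂ v₂) y ≡ dist (inj₂ v₄) y
  path-5-heads₂₄-twins (inj₁ _) _ _ _ = refl
  path-5-heads₂₄-twins (inj₂ fz) _ _ _ = refl
  path-5-heads₂₄-twins (inj₂ (fs fz)) ≢v₁ _ _ = ⊥-elim (≢v₁ refl)
  path-5-heads₂₄-twins (inj₂ (fs (fs fz))) _ ≢v₂ _ = ⊥-elim (≢v₂ refl)
  path-5-heads₂₄-twins (inj₂ (fs (fs (fs fz)))) _ _ _ = refl
  path-5-heads₂₄-twins (inj₂ (fs (fs (fs (fs fz))))) _ _ ≢v₄ = ⊥-elim (≢v₄ refl)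

  path-5-path-3-heads₀₂-twins : ∀ y → inj₂ v₃ ≢ y → inj₂ v₀ ≢ y → inj₂ v₂ ≢ y → dist (inj₂ v₀) y ≡ dist (inj₂ v₂) y
  path-5-path-3-heads₀₂-twins (inj₁ _) _ _ _ = refl
  path-5-path-3-heads₀₂-twins (inj₂ fz) _ ≢v₀ _ = ⊥-elim (≢v₀ refl)
  path-5-path-3-heads₀₂-twins (inj₂ (fs fz)) _ _ _ = refl
  path-5-path-3-heads₀₂-twins (inj₂ (fs (fs fz))) _ _ ≢v₂ = ⊥-elim (≢v₂ refl)
  path-5-path-3-heads₀₂-twins (inj₂ (fs (fs (fs fz)))) ≢v₃ _ _ = ⊥-elim (≢v₃ refl)
  path-5-path-3-heads₀₂-twins (inj₂ (fs (fs (fs (fs fz))))) _ _ _ = refl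

  -- Unless both tails lie in B, the heads v₂, v₄ (if v₁ ∉ B) or v₀, v₂ (if v₃ ∉ B)
  -- can only be told apart by one of themselves.
  path-5-lower-bound : ∀ B → Resolving D B → m + 2 ≤ length B
  path-5-lower-bound B res with inj₂ v₁ ∈? B | inj₂ v₃ ∈? B
  ... | yes v₁∈B | yes v₃∈B = lower-bound res [] [] (λ ()) 2
        (ℕ.≤-reflexive (sym (countIn-⊆ B λ { (here refl) → v₁∈B ; (there (here refl)) → v₃∈B })))
  ... | no v₁∉B | _ = twin-heads-lower-bound res v₂ v₄ refl refl (λ ())
        (λ v₂∉B v₄∉B y y∈B → path-5-heads₂₄-twins y (∉⇒≢ v₁∉B y∈B) (∉⇒≢ v₂∉B y∈B) (∉⇒≢ v₄∉B y∈B))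
        1 (ℕ.≤-pred (tails-inside res))
  ... | yes _ | no v₃∉B = twin-heads-lower-bound res v₀ v₂ refl refl (λ ())
        (λ v₀∉B v₂∉B y y∈B → path-5-path-3-heads₀₂-twins y (∉⇒≢ v₃∉B y∈B) (∉⇒≢ v₀∉B y∈B) (∉⇒≢ v₂∉B y∈B))
        1 (ℕ.≤-pred (tails-inside res))

metricDim-5 : ∀ m b → MetricDim (canonical {suc m} {5} b) (2 + m)
metricDim-5 m false = subst (MetricDim D) (ℕ.+-comm m 2)
  (withPath-MetricDim? (fs (fs fz) ∷ fs (fs (fs (fs fz))) ∷ []) (((λ ()) ∷ []) ∷ [] ∷ [])
    (ℕ.≤-trans (s≤s z≤n) (ℕ.m≤n+m 2 m)) (λ B → general-lower-bound))
  where open Canonical m 3 false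
metricDim-5 m true = subst (MetricDim D) (ℕ.+-comm m 2)
  (withPath-MetricDim? (fs fz ∷ fs (fs (fs fz)) ∷ []) (((λ ()) ∷ []) ∷ [] ∷ [])
    (ℕ.≤-trans (s≤s z≤n) (ℕ.m≤n+m 2 m)) (path-5-lower-bound m))
  where open Canonical m 3 true

-- Degrees of the centres

countTrue-fan : ∀ {m n} (g : FanV m n → Bool) (h : ℕ → Bool) →
  (∀ c → g (inj₁ c) ≡ false) → (∀ j → g (inj₂ j) ≡ h (toℕ j)) → countTrue (map g (allFanV m n)) ≡ count h n
countTrue-fan {m} {n} g h centres path = begin
  countTrue (map g (map inj₁ (allFin m) ++ map inj₂ (allFin n)))
    ≡⟨ cong countTrue (map-++ g (map inj₁ (allFin m)) (map inj₂ (allFin n))) ⟩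
  countTrue (map g (map inj₁ (allFin m)) ++ map g (map inj₂ (allFin n)))
    ≡⟨ countTrue-++ (map g (map inj₁ (allFin m))) _ ⟩
  countTrue (map g (map inj₁ (allFin m))) + countTrue (map g (map inj₂ (allFin n)))
    ≡⟨ cong₂ _+_ (trans (cong countTrue (sym (map-∘ (allFin m)))) (countTrue-map-false (g ∘ inj₁) centres (allFin m)))
                 (cong (countTrue ∘ map g) (map-tabulate (λ j → j) inj₂)) ⟩
  countTrue (map g (tabulate inj₂))
    ≡⟨ countTrue-map g (tabulate inj₂) ⟩
  length (filterᵇ g (tabulate inj₂))
    ≡⟨ length-filterᵇ-tabulate g h n inj₂ path ⟩
  count h n ∎
  where open ≡-Reasoning

outdeg-cong : ∀ {m n} {O O′ : Arcs (FanV m n)} → O ≗ᴬ O′ → ∀ x → outdeg O x ≡ outdeg O′ x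
outdeg-cong O≗O′ x = cong countTrue (map-cong (O≗O′ x) (allFanV _ _))

indeg-cong : ∀ {m n} {O O′ : Arcs (FanV m n)} → O ≗ᴬ O′ → ∀ x → indeg O x ≡ indeg O′ x
indeg-cong O≗O′ x = cong countTrue (map-cong (λ w → O≗O′ w x) (allFanV _ _))

centre-outdeg : ∀ {m n} b (c : Fin m) → outdeg (canonical {m} {n} b) (inj₁ c) ≡ tailsBelow (not b) n
centre-outdeg b c = countTrue-fan (canonical b (inj₁ c)) (not ∘ arcFromCentre (not b)) (λ _ → refl)
  (λ j → sym (trans (cong not (arcFromCentre-not b (toℕ j))) (not-involutive _)))

centre-indeg : ∀ {m n} b (c : Fin m) → indeg (canonical {m} {n} b) (inj₁ c) ≡ tailsBelow b n
centre-indeg b c = countTrue-fan (λ w → canonical b w (inj₁ c)) (not ∘ arcFromCentre b) (λ _ → refl) (λ _ → refl)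

tailsBelow-odd-false≮true : ∀ k → ¬ tailsBelow false (suc (2 * k)) < tailsBelow true (suc (2 * k))
tailsBelow-odd-false≮true k lt =
  ℕ.<⇒≱ (subst₂ _<_ (tailsBelow-odd false k) (tailsBelow-odd true k) lt) (ℕ.+-monoʳ-≤ k z≤n)

+-∸-shift : ∀ m k → m + k ≡ suc k + suc m ∸ 2
+-∸-shift m k = trans (ℕ.+-comm m k) (cong (_∸ 1) (sym (ℕ.+-suc k m)))

canonicalFan : (m n : ℕ) → Bool → Arcs (FanV (suc m) (suc (suc n)))
canonicalFan m n b = canonical b

dim-one-centre : ∀ m n b → suc m ≡ 1 → (suc (suc n) ≡ 2 ⊎ suc (suc n) ≡ 3 ⊎ suc (suc n) ≡ 4) →
  MetricDim (canonicalFan m n b) 1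
dim-one-centre zero _ b refl (inj₁ refl) = metricDim-1-2 b
dim-one-centre zero _ b refl (inj₂ (inj₁ refl)) = metricDim-3 0 b
dim-one-centre zero _ b refl (inj₂ (inj₂ refl)) = metricDim-4 0 b

dim-path-2 : ∀ m n b → 2 ≤ suc m → suc (suc n) ≡ 2 → MetricDim (canonicalFan m n b) (suc m ∸ 1)
dim-path-2 (suc m) _ b _ refl = metricDim-2 m b
dim-path-2 zero _ _ (s≤s ()) _

dim-path-3-4 : ∀ m n b → 2 ≤ suc m → (suc (suc n) ≡ 3 ⊎ suc (suc n) ≡ 4) → MetricDim (canonicalFan m n b) (suc m)
dim-path-3-4 m _ b _ (inj₁ refl) = metricDim-3 m b
dim-path-3-4 m _ b _ (inj₂ refl) = metricDim-4 m b

dim-path-5 : ∀ m n b → 2 ≤ suc m → suc (suc n) ≡ 5 → MetricDim (canonicalFan m n b) (suc (suc m))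
dim-path-5 m _ b _ refl = metricDim-5 m b

dim-even : ∀ m n b k → 3 ≤ k → suc (suc n) ≡ 2 * k → MetricDim (canonicalFan m n b) (k + suc m ∸ 2)
dim-even m n b (suc k) (s≤s 2≤k) N≡2k with ℕ.suc-injective (ℕ.suc-injective (trans N≡2k (ℕ.*-suc 2 k)))
... | refl = subst (MetricDim (canonical b)) (trans (cong (m +_) (tailsBelow-even b k)) (+-∸-shift m k))
  (Canonical.metricDim-large m n b (ℕ.*-monoʳ-≤ 2 2≤k))

module _ (m n k : ℕ) (N≡2k+1 : suc (suc n) ≡ suc (2 * suc k)) where

  private
    n≡2k+1 : n ≡ suc (2 * k)
    n≡2k+1 = ℕ.suc-injective (ℕ.suc-injective (trans N≡2k+1 (cong suc (ℕ.*-suc 2 k))))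

  -- the degree condition forces the value of b, by tailsBelow-odd
  dim-odd-outward : ∀ b → 2 ≤ k → (∀ i → indeg (canonicalFan m n b) (inj₁ i) < outdeg (canonicalFan m n b) (inj₁ i)) →
    MetricDim (canonicalFan m n b) (suc k + suc m ∸ 2)
  dim-odd-outward true 2≤k _ rewrite n≡2k+1 = subst (MetricDim (canonical true))
    (trans (cong (m +_) (trans (tailsBelow-odd true k) (ℕ.+-identityʳ k))) (+-∸-shift m k))
    (Canonical.metricDim-large m _ true (ℕ.≤-trans (ℕ.*-monoʳ-≤ 2 2≤k) (ℕ.n≤1+n _)))
  dim-odd-outward false _ outward = ⊥-elim (tailsBelow-odd-false≮true (suc k)
    (subst₂ _<_ (trans (centre-indeg {suc m} {suc (suc n)} false fz) (cong (tailsBelow false) N≡2k+1))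
                (trans (centre-outdeg {suc m} {suc (suc n)} false fz) (cong (tailsBelow true) N≡2k+1)) (outward fz)))

  dim-odd-inward : ∀ b → 2 ≤ k → (∀ i → outdeg (canonicalFan m n b) (inj₁ i) < indeg (canonicalFan m n b) (inj₁ i)) →
    MetricDim (canonicalFan m n b) (suc k + suc m ∸ 1)
  dim-odd-inward false 2≤k _ rewrite n≡2k+1 = subst (MetricDim (canonical false))
    (trans (cong (m +_) (trans (tailsBelow-odd false k) (ℕ.+-comm k 1))) (trans (ℕ.+-comm m (suc k)) (sym (ℕ.+-suc k m))))
    (Canonical.metricDim-large m _ false (ℕ.≤-trans (ℕ.*-monoʳ-≤ 2 2≤k) (ℕ.n≤1+n _)))
  dim-odd-inward true _ inward = ⊥-elim (tailsBelow-odd-false≮true (suc k)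
    (subst₂ _<_ (trans (centre-outdeg {suc m} {suc (suc n)} true fz) (cong (tailsBelow false) N≡2k+1))
                (trans (centre-indeg {suc m} {suc (suc n)} true fz) (cong (tailsBelow true) N≡2k+1)) (inward fz)))

FanDimensions : (m n : ℕ) → Arcs (FanV m n) → Set
FanDimensions m n O =
  (m ≡ 1 → (n ≡ 2 ⊎ n ≡ 3 ⊎ n ≡ 4) → MetricDim O 1)
  × (2 ≤ m → n ≡ 2 → MetricDim O (m ∸ 1))
  × (2 ≤ m → (n ≡ 3 ⊎ n ≡ 4) → MetricDim O m)
  × (2 ≤ m → n ≡ 5 → MetricDim O (suc m))
  × (∀ k → 3 ≤ k → n ≡ 2 * k → MetricDim O (k + m ∸ 2))
  × (∀ k → 3 ≤ k → n ≡ suc (2 * k) →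
       (∀ (i : Fin m) → indeg O (inj₁ i) < outdeg O (inj₁ i)) →
       MetricDim O (k + m ∸ 2))
  × (∀ k → 3 ≤ k → n ≡ suc (2 * k) →
       (∀ (i : Fin m) → outdeg O (inj₁ i) < indeg O (inj₁ i)) →
       MetricDim O (k + m ∸ 1))

FanDimensions-cong : ∀ {m n} {O O′ : Arcs (FanV m n)} → O ≗ᴬ O′ → FanDimensions m n O → FanDimensions m n O′
FanDimensions-cong {O = O} {O′} O≗O′ (d₁ , d₂ , d₃ , d₄ , d₅ , d₆ , d₇) =
  (λ p q → transport (d₁ p q)) , (λ p q → transport (d₂ p q)) , (λ p q → transport (d₃ p q)) ,
  (λ p q → transport (d₄ p q)) , (λ k p q → transport (d₅ k p q)) ,
  (λ k p q deg → transport (d₆ k p q (λ i → subst₂ _<_ (indeg-cong O′≗O _) (outdeg-cong O′≗O _) (deg i)))) ,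
  (λ k p q deg → transport (d₇ k p q (λ i → subst₂ _<_ (outdeg-cong O′≗O _) (indeg-cong O′≗O _) (deg i))))
  where
  O′≗O : O′ ≗ᴬ O
  O′≗O = ≗ᴬ-sym O≗O′
  transport : ∀ {d} → MetricDim O d → MetricDim O′ d
  transport = MetricDim-cong O≗O′

canonical-FanDimensions : ∀ m n b → FanDimensions (suc m) (suc (suc n)) (canonical b)
canonical-FanDimensions m n b =
  dim-one-centre m n b , dim-path-2 m n b , dim-path-3-4 m n b , dim-path-5 m n b , dim-even m n b ,
  (λ { (suc k) (s≤s 2≤k) N≡ → dim-odd-outward m n k N≡ b 2≤k }) ,
  (λ { (suc k) (s≤s 2≤k) N≡ → dim-odd-inward m n k N≡ b 2≤k })

mainTheorem3 : ∀ (m n : ℕ) → 1 ≤ m → 2 ≤ n →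
  (O : Arcs (FanV m n)) → IsFanOrientation O → C3Simple O →
    (m ≡ 1 → (n ≡ 2 ⊎ n ≡ 3 ⊎ n ≡ 4) → MetricDim O 1)
    × (2 ≤ m → n ≡ 2 → MetricDim O (m ∸ 1))
    × (2 ≤ m → (n ≡ 3 ⊎ n ≡ 4) → MetricDim O m)
    × (2 ≤ m → n ≡ 5 → MetricDim O (suc m))
    × (∀ k → 3 ≤ k → n ≡ 2 * k → MetricDim O (k + m ∸ 2))
    × (∀ k → 3 ≤ k → n ≡ suc (2 * k) →
         (∀ (i : Fin m) → indeg O (inj₁ i) < outdeg O (inj₁ i)) →
         MetricDim O (k + m ∸ 2))
    × (∀ k → 3 ≤ k → n ≡ suc (2 * k) →
         (∀ (i : Fin m) → outdeg O (inj₁ i) < indeg O (inj₁ i)) →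
         MetricDim O (k + m ∸ 1))
mainTheorem3 (suc m) (suc (suc n)) (s≤s z≤n) (s≤s (s≤s z≤n)) O orientation c3
  with C3Simple⇒canonical orientation c3
... | b , O≗canonical = FanDimensions-cong (≗ᴬ-sym O≗canonical) (canonical-FanDimensions m n b)
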